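{- Let $k\ge 3$, $n\ge 2$, $0\le i\le k$. Let $W$ be the inclusion matrix of the second level of the Hamming lattice $\mathcal{H}_{k,n}$ versus its top level $[n]^k$ and $A_i$ the $i$th adjacency matrix of the Hamming scheme $H(k,n)$. Then $WA_iW^\top = F_0(k-2,i)A'_0 + F_0(k-2,i-1)A'_1 + F_0(k-2,i-2)A'_2 + F_1(k-3,i)A'_3 + F_1(k-3,i-1)A'_4 + F_2(k-4,i)A'_5$, where $F_s(h,i) := n^h(n-1)^i \sum_{l=0}^{2s}\binom{h}{i-l}\binom{2s}{l}$.
   Context: The Hamming lattice $\mathcal{H}_{k,n}$ has ground set $([n]\cup\{*\})^k$, ordered by $x\preceq y$ iff $x_j\in\{y_j,*\}$ for all $j$; the second level consists of subwords with exactly two non-$*$ coordinates, viewed as edges $e$ of the complete $k$-partite graph with parts of size $n$ (the $k$ coordinates being the parts). The inclusion matrix has $(e,a)$-entry $1$ if $e\preceq a$, else $0$. $A_i$ has $(a,b)$-entry $1$ iff $a,b\in[n]^k$ are at Hamming distance $i$. On edges: $A'_0 = I$; $A'_1$: distinct edges joining the same pair of parts and sharing a vertex; $A'_2$: disjoint edges joining the same pair of parts; $A'_3$: edges sharing a vertex and touching exactly three parts; $A'_4$: disjoint edges touching exactly three parts; $A'_5$: disjoint edges touching four parts (each $A'_h$ is the $0/1$ adjacency matrix of that relation; $A'_5=O$ when $k=3$, in which case its term is absent). Binomial coefficients $\binom{h}{m}$ are $0$ for $m<0$ or $m>h$. -}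

module Defs where

open import Data.Nat using (ℕ; zero; suc; _+_; _*_; _∸_; _^_)
open import Data.Nat.Combinatorics using (_C_)
open import Data.Integer as ℤ using (ℤ; +_; -[1+_])
open import Data.Fin using (Fin; _≟_)
open import Data.Fin.Properties using () renaming (_≟_ to _≟F_)
open import Data.List using (List; map; allFin; upTo)
open import Data.Nat.ListAction using (sum)
open import Data.Maybe using (Maybe; just; nothing; is-just)
open import Data.Bool using (Bool; true; false; if_then_else_; _∧_; _∨_; not)
open import Data.Vec.Functional using (_∷_)
open import Data.Product using (Σ; proj₁)
open import Relation.Binary.PropositionalEquality using (_≡_)
open import Relation.Nullary.Decidable using (⌊_⌋)

ΣFin : (k : ℕ) → (Fin k → ℕ) → ℕ
ΣFin k f = sum (map f (allFin k))

count : (k : ℕ) → (Fin k → Bool) → ℕ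
count k p = ΣFin k (λ j → if p j then 1 else 0)

allB : (k : ℕ) → (Fin k → Bool) → Bool
allB zero p = true
allB (suc k) p = p Fin.zero ∧ allB k (λ j → p (Fin.suc j))
  where import Data.Fin as Fin

χ : Bool → ℕ
χ b = if b then 1 else 0

Word : ℕ → ℕ → Set
Word k n = Fin k → Fin n

-- Ground set of H_{k,n}: ([n] ∪ {*})^k, with nothing playing the role of *
SubWord : ℕ → ℕ → Set
SubWord k n = Fin k → Maybe (Fin n)

ΣWord : (k n : ℕ) → (Word k n → ℕ) → ℕ
ΣWord zero n f = f (λ ())
ΣWord (suc k) n f = ΣFin n (λ v → ΣWord k n (λ w → f (v ∷ w)))

suppSize : {k n : ℕ} → SubWord k n → ℕ
suppSize {k} x = count k (λ j → is-just (x j))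

-- Second level: subwords with exactly two non-* coordinates (edges of the
-- complete k-partite graph with parts of size n)
Edge : ℕ → ℕ → Set
Edge k n = Σ (SubWord k n) (λ x → suppSize x ≡ 2)

eqMaybe : {n : ℕ} → Maybe (Fin n) → Maybe (Fin n) → Bool
eqMaybe nothing nothing = true
eqMaybe nothing (just _) = false
eqMaybe (just _) nothing = false
eqMaybe (just u) (just v) = ⌊ u ≟F v ⌋

precB : {k n : ℕ} → SubWord k n → Word k n → Bool
precB {k} x a = allB k (λ j → compat (x j) (a j))
  where
  compat : Maybe (Fin _) → Fin _ → Bool
  compat nothing _ = true
  compat (just u) v = ⌊ u ≟F v ⌋

W : {k n : ℕ} → Edge k n → Word k n → ℕ
W e a = χ (precB (proj₁ e) a)

hamming : {k n : ℕ} → Word k n → Word k n → ℕ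
hamming {k} a b = count k (λ j → not ⌊ a j ≟F b j ⌋)

A : {k n : ℕ} → ℕ → Word k n → Word k n → ℕ
A i a b = χ ⌊ hamming a b Data.Nat.≟ i ⌋
  where import Data.Nat

WAWᵀ : (k n i : ℕ) → Edge k n → Edge k n → ℕ
WAWᵀ k n i e f = ΣWord k n (λ a → ΣWord k n (λ b → W e a * A i a b * W f b))

sameEdge : {k n : ℕ} → Edge k n → Edge k n → Bool
sameEdge {k} e f = allB k (λ j → eqMaybe (proj₁ e j) (proj₁ f j))

sameParts : {k n : ℕ} → Edge k n → Edge k n → Bool
sameParts {k} e f = allB k (λ j → ⌊ is-just (proj₁ e j) Data.Bool.≟ is-just (proj₁ f j) ⌋)
  where import Data.Bool

-- number of common vertices (vertex = (part j, value v))
sharedVertices : {k n : ℕ} → Edge k n → Edge k n → ℕ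
sharedVertices {k} e f = count k (λ j → is-just (proj₁ e j) ∧ eqMaybe (proj₁ e j) (proj₁ f j))

shareVertex : {k n : ℕ} → Edge k n → Edge k n → Bool
shareVertex e f = not ⌊ sharedVertices e f Data.Nat.≟ 0 ⌋
  where import Data.Nat

partsTouched : {k n : ℕ} → Edge k n → Edge k n → ℕ
partsTouched {k} e f = count k (λ j → is-just (proj₁ e j) ∨ is-just (proj₁ f j))

touches : {k n : ℕ} → ℕ → Edge k n → Edge k n → Bool
touches m e f = ⌊ partsTouched e f Data.Nat.≟ m ⌋
  where import Data.Nat

A'₀ A'₁ A'₂ A'₃ A'₄ A'₅ : {k n : ℕ} → Edge k n → Edge k n → ℕ
A'₀ e f = χ (sameEdge e f)
A'₁ e f = χ (not (sameEdge e f) ∧ sameParts e f ∧ shareVertex e f)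
A'₂ e f = χ (sameParts e f ∧ not (shareVertex e f))
A'₃ e f = χ (shareVertex e f ∧ touches 3 e f)
A'₄ e f = χ (not (shareVertex e f) ∧ touches 3 e f)
A'₅ e f = χ (not (shareVertex e f) ∧ touches 4 e f)

-- binomial coefficient with integer lower index, 0 for negative index
-- (and _C_ already gives 0 when the lower index exceeds the upper)
binomℤ : ℕ → ℤ → ℕ
binomℤ h (+ m) = h C m
binomℤ h -[1+ _ ] = 0

-- F_s(h,i) = n^h (n-1)^i Σ_{l=0}^{2s} C(h, i-l) C(2s, l).
-- For i < 0 every binomial C(h, i-l) vanishes, so F_s(h,i) = 0.
F : (n s h : ℕ) → ℤ → ℕ
F n s h (+ i) = n ^ h * (n ∸ 1) ^ i *
  sum (map (λ l → binomℤ h ((+ i) ℤ.- (+ l)) * ((2 * s) C l)) (upTo (suc (2 * s))))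
F n s h -[1+ _ ] = 0

module Submission where

-- For subwords x, y the entry Σ_{a ⪰ x, b ⪰ y} [d(a,b) = i] factorises over the coordinates.  In
-- the generating variable z that marks a disagreement, a coordinate where x and y are both * contributes
-- n (1 + (n-1) z), one where exactly one of them is * contributes 1 + (n-1) z, two equal letters contribute 1
-- and two distinct letters z.  So with h, c, d coordinates of these kinds the entry is the coefficient of z^i
-- in z^d n^h (1 + (n-1) z)^(h+c), namely n^h (n-1)^(i-d) C(h+c, i-d).  For two edges both supports have
-- size 2, which leaves six possible profiles, one for each relation A'₀, …, A'₅, and in each of them
-- Vandermonde's identity C(h+2s, i) = Σ_l C(h, i-l) C(2s, l) rewrites the coefficient as F_s.

open import Defs
open import Data.Bool using (Bool; true; false; _∧_; _∨_; not; if_then_else_)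
import Data.Bool as Bool
open import Data.Fin using (Fin; zero; suc)
open import Data.Fin.Patterns using (0F; 1F; 2F; 3F; 4F; 5F)
open import Data.Fin.Properties using () renaming (_≟_ to _≟F_)
open import Data.Integer using (ℤ; +_; -[1+_]; _⊖_; _-_)
open import Data.Integer.Properties using ([1+m]⊖[1+n]≡m⊖n; m-n≡m⊖n)
open import Data.List using (map; tabulate; upTo)
open import Data.List.Properties using (map-cong; map-tabulate)
open import Data.Maybe using (Maybe; just; nothing; is-just)
open import Data.Nat using (ℕ; zero; suc; _+_; _*_; _∸_; _^_; _≤_; z≤n; s≤s; _≡ᵇ_)
import Data.Nat as ℕ
open import Data.Nat.Combinatorics using (_C_; nCk+nC[k+1]≡[n+1]C[k+1])
open import Data.Nat.ListAction using () renaming (sum to sumList)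
open import Data.Nat.Properties
open import Data.Nat.Tactic.RingSolver using (solve-∀)
open import Algebra.Properties.CommutativeSemigroup +-commutativeSemigroup using (x∙yz≈y∙xz)
open import Algebra.Properties.Semiring.Sum +-*-semiring
  using (sum; sum-cong-≗; ∑-distrib-+; ∑-comm; *-distribˡ-sum)
open import Data.Product using (proj₁; proj₂)
open import Data.Vec.Functional using (_∷_; head; tail)
open import Function using (_∘_)
open import Relation.Binary.PropositionalEquality
open import Relation.Nullary.Decidable using (⌊_⌋; yes; no; ⌊⌋-map′)
open import Relation.Nullary.Negation using (contradiction)

open ≡-Reasoning

ΣFin≡sum : ∀ k (f : Fin k → ℕ) → ΣFin k f ≡ sum f
ΣFin≡sum zero    f = refl
ΣFin≡sum (suc k) f = cong (_+_ (f zero)) (begin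
  sumList (map f (tabulate suc))   ≡⟨ cong sumList (map-tabulate suc f) ⟩
  sumList (tabulate (f ∘ suc))     ≡⟨ cong sumList (map-tabulate (λ j → j) (f ∘ suc)) ⟨
  ΣFin k (f ∘ suc)                 ≡⟨ ΣFin≡sum k (f ∘ suc) ⟩
  sum (f ∘ suc)                    ∎)

ΣFin-suc : ∀ k (f : Fin (suc k) → ℕ) → ΣFin (suc k) f ≡ f zero + ΣFin k (f ∘ suc)
ΣFin-suc k f = trans (ΣFin≡sum (suc k) f) (cong (_+_ (f zero)) (sym (ΣFin≡sum k (f ∘ suc))))

ΣFin-cong : ∀ k {f g : Fin k → ℕ} → (∀ j → f j ≡ g j) → ΣFin k f ≡ ΣFin k g
ΣFin-cong k {f} {g} f≗g = begin
  ΣFin k f  ≡⟨ ΣFin≡sum k f ⟩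
  sum f     ≡⟨ sum-cong-≗ f≗g ⟩
  sum g     ≡⟨ ΣFin≡sum k g ⟨
  ΣFin k g  ∎

ΣFin-+ : ∀ k (f g : Fin k → ℕ) → ΣFin k (λ j → f j + g j) ≡ ΣFin k f + ΣFin k g
ΣFin-+ k f g = begin
  ΣFin k (λ j → f j + g j)  ≡⟨ ΣFin≡sum k _ ⟩
  sum (λ j → f j + g j)     ≡⟨ ∑-distrib-+ f g ⟩
  sum f + sum g             ≡⟨ cong₂ _+_ (ΣFin≡sum k f) (ΣFin≡sum k g) ⟨
  ΣFin k f + ΣFin k g       ∎

ΣFin-*ˡ : ∀ k c (f : Fin k → ℕ) → ΣFin k (λ j → c * f j) ≡ c * ΣFin k f
ΣFin-*ˡ k c f = begin
  ΣFin k (λ j → c * f j)  ≡⟨ ΣFin≡sum k _ ⟩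
  sum (λ j → c * f j)     ≡⟨ *-distribˡ-sum c f ⟨
  c * sum f               ≡⟨ cong (c *_) (ΣFin≡sum k f) ⟨
  c * ΣFin k f            ∎

ΣFin-const : ∀ k c → ΣFin k (λ _ → c) ≡ k * c
ΣFin-const zero    c = refl
ΣFin-const (suc k) c = trans (ΣFin-suc k _) (cong (_+_ c) (ΣFin-const k c))

ΣFin-comm : ∀ m n (f : Fin m → Fin n → ℕ) →
  ΣFin m (λ i → ΣFin n (f i)) ≡ ΣFin n (λ j → ΣFin m (λ i → f i j))
ΣFin-comm m n f = begin
  ΣFin m (λ i → ΣFin n (f i))          ≡⟨ ΣFin-cong m (λ i → ΣFin≡sum n (f i)) ⟩
  ΣFin m (λ i → sum (f i))             ≡⟨ ΣFin≡sum m _ ⟩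
  sum (λ i → sum (f i))                ≡⟨ ∑-comm f ⟩
  sum (λ j → sum (λ i → f i j))        ≡⟨ ΣFin≡sum n _ ⟨
  ΣFin n (λ j → sum (λ i → f i j))     ≡⟨ ΣFin-cong n (λ j → ΣFin≡sum m (λ i → f i j)) ⟨
  ΣFin n (λ j → ΣFin m (λ i → f i j))  ∎

⌊suc≟suc⌋ : ∀ {n} (u v : Fin n) → ⌊ suc u ≟F suc v ⌋ ≡ ⌊ u ≟F v ⌋
⌊suc≟suc⌋ u v = ⌊⌋-map′ _ _ (u ≟F v)

⌊≟⌋-sym : ∀ {n} (u v : Fin n) → ⌊ u ≟F v ⌋ ≡ ⌊ v ≟F u ⌋
⌊≟⌋-sym u v with u ≟F v | v ≟F u
... | yes _   | yes _   = refl
... | no _    | no _    = refl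
... | yes u≡v | no v≢u  = contradiction (sym u≡v) v≢u
... | no u≢v  | yes v≡u = contradiction (sym v≡u) u≢v

ΣFin-select : ∀ n (u : Fin n) (g : Fin n → ℕ) → ΣFin n (λ v → χ ⌊ u ≟F v ⌋ * g v) ≡ g u
ΣFin-select (suc n) zero g = begin
  ΣFin (suc n) (λ v → χ ⌊ zero ≟F v ⌋ * g v)  ≡⟨ ΣFin-suc n _ ⟩
  (g zero + 0) + ΣFin n (λ _ → 0)              ≡⟨ cong₂ _+_ (+-identityʳ (g zero)) (ΣFin-const n 0) ⟩
  g zero + n * 0                               ≡⟨ cong (_+_ (g zero)) (*-zeroʳ n) ⟩
  g zero + 0                                   ≡⟨ +-identityʳ (g zero) ⟩
  g zero                                       ∎
ΣFin-select (suc n) (suc u) g = begin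
  ΣFin (suc n) (λ v → χ ⌊ suc u ≟F v ⌋ * g v)
    ≡⟨ ΣFin-suc n (λ v → χ ⌊ suc u ≟F v ⌋ * g v) ⟩
  ΣFin n (λ v → χ ⌊ suc u ≟F suc v ⌋ * g (suc v))
    ≡⟨ ΣFin-cong n (λ v → cong (λ b → χ b * g (suc v)) (⌊suc≟suc⌋ u v)) ⟩
  ΣFin n (λ v → χ ⌊ u ≟F v ⌋ * g (suc v))
    ≡⟨ ΣFin-select n u (g ∘ suc) ⟩
  g (suc u) ∎

ΣFin-split-≟ : ∀ m (u : Fin (suc m)) (Z : Bool → ℕ) →
  ΣFin (suc m) (λ v → Z ⌊ u ≟F v ⌋) ≡ Z true + m * Z false
ΣFin-split-≟ m zero Z = trans (ΣFin-suc m _) (cong (_+_ (Z true)) (ΣFin-const m (Z false)))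
ΣFin-split-≟ (suc m) (suc u) Z = begin
  ΣFin (suc (suc m)) (λ v → Z ⌊ suc u ≟F v ⌋)
    ≡⟨ ΣFin-suc (suc m) (λ v → Z ⌊ suc u ≟F v ⌋) ⟩
  Z false + ΣFin (suc m) (λ v → Z ⌊ suc u ≟F suc v ⌋)
    ≡⟨ cong (_+_ (Z false)) (ΣFin-cong (suc m) (λ v → cong Z (⌊suc≟suc⌋ u v))) ⟩
  Z false + ΣFin (suc m) (λ v → Z ⌊ u ≟F v ⌋)
    ≡⟨ cong (_+_ (Z false)) (ΣFin-split-≟ m u Z) ⟩
  Z false + (Z true + m * Z false)
    ≡⟨ x∙yz≈y∙xz (Z false) (Z true) _ ⟩
  Z true + suc m * Z false ∎

ΣWord-cong : ∀ k n {f g : Word k n → ℕ} → (∀ w → f w ≡ g w) → ΣWord k n f ≡ ΣWord k n g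
ΣWord-cong zero    n f≗g = f≗g _
ΣWord-cong (suc k) n f≗g = ΣFin-cong n (λ v → ΣWord-cong k n (λ w → f≗g (v ∷ w)))

ΣWord-*ˡ : ∀ k n c (f : Word k n → ℕ) → ΣWord k n (λ w → c * f w) ≡ c * ΣWord k n f
ΣWord-*ˡ zero    n c f = refl
ΣWord-*ˡ (suc k) n c f = trans (ΣFin-cong n (λ v → ΣWord-*ˡ k n c _)) (ΣFin-*ˡ n c _)

ΣWord²-*ˡ : ∀ k n c (f : Word k n → Word k n → ℕ) →
  ΣWord k n (λ w → ΣWord k n (λ w′ → c * f w w′)) ≡ c * ΣWord k n (λ w → ΣWord k n (f w))
ΣWord²-*ˡ k n c f = trans (ΣWord-cong k n (λ w → ΣWord-*ˡ k n c (f w))) (ΣWord-*ˡ k n c _)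

ΣWord-zero : ∀ k n → ΣWord k n (λ _ → 0) ≡ 0
ΣWord-zero k n = ΣWord-*ˡ k n 0 (λ _ → 0)

ΣWord-ΣFin-comm : ∀ k n n′ (g : Word k n → Fin n′ → ℕ) →
  ΣWord k n (λ w → ΣFin n′ (g w)) ≡ ΣFin n′ (λ v → ΣWord k n (λ w → g w v))
ΣWord-ΣFin-comm zero    n n′ g = refl
ΣWord-ΣFin-comm (suc k) n n′ g =
  trans (ΣFin-cong n (λ v → ΣWord-ΣFin-comm k n n′ (g ∘ (v ∷_)))) (ΣFin-comm n n′ _)

-- shift d g is the coefficient sequence of z^d · g(z).
shift : ℕ → (ℕ → ℕ) → ℕ → ℕ
shift zero    g i       = g i
shift (suc d) g zero    = 0
shift (suc d) g (suc i) = shift d g i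

shift-cong : ∀ {g g′ : ℕ → ℕ} → (∀ i → g i ≡ g′ i) → ∀ d i → shift d g i ≡ shift d g′ i
shift-cong g≗g′ zero    i       = g≗g′ i
shift-cong g≗g′ (suc d) zero    = refl
shift-cong g≗g′ (suc d) (suc i) = shift-cong g≗g′ d i

shift-scale : ∀ a b d (g : ℕ → ℕ) i → a * shift d g i * b ≡ shift d (λ j → a * g j * b) i
shift-scale a b zero    g i       = refl
shift-scale a b (suc d) g zero    = cong (_* b) (*-zeroʳ a)
shift-scale a b (suc d) g (suc i) = shift-scale a b d g i

ΣWord-shift : ∀ k n d (g : Word k n → ℕ → ℕ) i →
  ΣWord k n (λ w → shift d (g w) i) ≡ shift d (λ j → ΣWord k n (λ w → g w j)) i
ΣWord-shift k n zero    g i       = refl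
ΣWord-shift k n (suc d) g zero    = ΣWord-zero k n
ΣWord-shift k n (suc d) g (suc i) = ΣWord-shift k n d g i

ΣWord²-shift : ∀ k n d (g : Word k n → Word k n → ℕ → ℕ) i →
  ΣWord k n (λ w → ΣWord k n (λ w′ → shift d (g w w′) i))
    ≡ shift d (λ j → ΣWord k n (λ w → ΣWord k n (λ w′ → g w w′ j))) i
ΣWord²-shift k n d g i =
  trans (ΣWord-cong k n (λ w → ΣWord-shift k n d (g w) i)) (ΣWord-shift k n d _ i)

shift-indicator : ∀ d h i → shift d (λ j → χ ⌊ h ℕ.≟ j ⌋) i ≡ χ ⌊ d + h ℕ.≟ i ⌋
shift-indicator zero    h i       = refl
shift-indicator (suc d) h zero    = refl
shift-indicator (suc d) h (suc i) =
  trans (shift-indicator d h i) (cong χ (sym (trans (⌊⌋-map′ _ _ _) (sym (⌊⌋-map′ _ _ _)))))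

g[i⊖d]≡shift : ∀ (g : ℤ → ℕ) → (∀ j → g -[1+ j ] ≡ 0) →
  ∀ d i → g (i ⊖ d) ≡ shift d (g ∘ +_) i
g[i⊖d]≡shift g g⁻≡0 zero    i       = refl
g[i⊖d]≡shift g g⁻≡0 (suc d) zero    = g⁻≡0 d
g[i⊖d]≡shift g g⁻≡0 (suc d) (suc i) =
  trans (cong g ([1+m]⊖[1+n]≡m⊖n i d)) (g[i⊖d]≡shift g g⁻≡0 d i)

g[i-d]≡shift : ∀ (g : ℤ → ℕ) → (∀ j → g -[1+ j ] ≡ 0) →
  ∀ d i → g (+ i - + d) ≡ shift d (g ∘ +_) i
g[i-d]≡shift g g⁻≡0 d i = trans (cong g (m-n≡m⊖n i d)) (g[i⊖d]≡shift g g⁻≡0 d i)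

-- Pairs of words above two subwords

precCoord : ∀ {n} → Maybe (Fin n) → Fin n → Bool
precCoord nothing  _ = true
precCoord (just u) v = ⌊ u ≟F v ⌋

precB-∷ : ∀ {k n} (x : SubWord (suc k) n) v (w : Word k n) →
  precB x (v ∷ w) ≡ precCoord (head x) v ∧ precB (tail x) w
precB-∷ x v w with head x
... | nothing = refl
... | just _  = refl

A-∷ : ∀ {k n} i (v v′ : Fin n) (w w′ : Word k n) →
  A i (v ∷ w) (v′ ∷ w′) ≡ shift (χ (not ⌊ v ≟F v′ ⌋)) (λ j → A j w w′) i
A-∷ {k} i v v′ w w′ = begin
  χ ⌊ hamming (v ∷ w) (v′ ∷ w′) ℕ.≟ i ⌋           ≡⟨ cong (λ h → χ ⌊ h ℕ.≟ i ⌋) (ΣFin-suc k _) ⟩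
  χ ⌊ χ (not ⌊ v ≟F v′ ⌋) + hamming w w′ ℕ.≟ i ⌋  ≡⟨ shift-indicator _ (hamming w w′) i ⟨
  shift (χ (not ⌊ v ≟F v′ ⌋)) (λ j → A j w w′) i  ∎

χ-∧ : ∀ a b → χ (a ∧ b) ≡ χ a * χ b
χ-∧ false b = refl
χ-∧ true  b = sym (+-identityʳ (χ b))

-- WAWᵀ k n i e f unfolds to pairsAt (proj₁ e) (proj₁ f) i.
pairsAt : ∀ {k n} → SubWord k n → SubWord k n → ℕ → ℕ
pairsAt {k} {n} x y i = ΣWord k n (λ a → ΣWord k n (λ b → χ (precB x a) * A i a b * χ (precB y b)))

pairsAt-∷ : ∀ k n (x y : SubWord (suc k) n) i →
  pairsAt x y i ≡ ΣFin n (λ v → χ (precCoord (head x) v) * ΣFin n (λ v′ → χ (precCoord (head y) v′) *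
                    shift (χ (not ⌊ v ≟F v′ ⌋)) (pairsAt (tail x) (tail y)) i))
pairsAt-∷ k n x y i = begin
  pairsAt x y i
    ≡⟨ ΣFin-cong n (λ v → ΣWord-ΣFin-comm k n n _) ⟩
  ΣFin n (λ v → ΣFin n (λ v′ → ΣWord k n (λ w → ΣWord k n (λ w′ →
    χ (precB x (v ∷ w)) * A i (v ∷ w) (v′ ∷ w′) * χ (precB y (v′ ∷ w′))))))
    ≡⟨ ΣFin-cong n (λ v → ΣFin-cong n (λ v′ → ΣWord-cong k n (λ w → ΣWord-cong k n (λ w′ →
         peelHead v v′ w w′)))) ⟩
  ΣFin n (λ v → ΣFin n (λ v′ → ΣWord k n (λ w → ΣWord k n (λ w′ →
    cx v * (cy v′ * shift (d v v′) (term w w′) i)))))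
    ≡⟨ ΣFin-cong n (λ v → ΣFin-cong n (λ v′ → pullOut (cx v) (cy v′) (d v v′))) ⟩
  ΣFin n (λ v → ΣFin n (λ v′ → cx v * (cy v′ * shift (d v v′) (pairsAt x′ y′) i)))
    ≡⟨ ΣFin-cong n (λ v → ΣFin-*ˡ n (cx v) _) ⟩
  ΣFin n (λ v → cx v * ΣFin n (λ v′ → cy v′ * shift (d v v′) (pairsAt x′ y′) i)) ∎
  where
  x′ = tail x
  y′ = tail y
  cx = λ v → χ (precCoord (head x) v)
  cy = λ v′ → χ (precCoord (head y) v′)
  d  = λ v v′ → χ (not ⌊ v ≟F v′ ⌋)

  term : Word k n → Word k n → ℕ → ℕ
  term w w′ j = χ (precB x′ w) * A j w w′ * χ (precB y′ w′)

  peelHead : ∀ v v′ w w′ → χ (precB x (v ∷ w)) * A i (v ∷ w) (v′ ∷ w′) * χ (precB y (v′ ∷ w′))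
                             ≡ cx v * (cy v′ * shift (d v v′) (term w w′) i)
  peelHead v v′ w w′
    rewrite precB-∷ x v w | precB-∷ y v′ w′ | A-∷ i v v′ w w′
          | χ-∧ (precCoord (head x) v) (precB x′ w) | χ-∧ (precCoord (head y) v′) (precB y′ w′)
          | sym (shift-scale (χ (precB x′ w)) (χ (precB y′ w′)) (d v v′) (λ j → A j w w′) i)
    = reorder (cx v) (χ (precB x′ w)) (shift (d v v′) (λ j → A j w w′) i) (cy v′) (χ (precB y′ w′))
    where
    reorder : ∀ a b s c e → a * b * s * (c * e) ≡ a * (c * (b * s * e))
    reorder = solve-∀

  pullOut : ∀ a c e → ΣWord k n (λ w → ΣWord k n (λ w′ → a * (c * shift e (term w w′) i)))
                        ≡ a * (c * shift e (pairsAt x′ y′) i)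
  pullOut a c e =
    trans (ΣWord²-*ˡ k n a _)
      (cong (a *_) (trans (ΣWord²-*ˡ k n c _) (cong (c *_) (ΣWord²-shift k n e term i))))

-- The closed form

-- closedForm m h c d is the coefficient sequence of z^d · n^h · (1 + m z)^(h + c), where n = m + 1.
closedForm : ℕ → ℕ → ℕ → ℕ → ℕ → ℕ
closedForm m h c d = shift d (λ i → suc m ^ h * m ^ i * ((c + h) C i))

closedForm-oneFree : ∀ m h c d i →
  closedForm m h (suc c) d i ≡ closedForm m h c d i + m * closedForm m h c (suc d) i
closedForm-oneFree m h c zero zero =
  sym (trans (cong (_+_ (suc m ^ h * 1 * 1)) (*-zeroʳ m)) (+-identityʳ _))
closedForm-oneFree m h c zero (suc i) = begin
  a * (m * p) * (suc (c + h) C suc i)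
    ≡⟨ cong (a * (m * p) *_) (nCk+nC[k+1]≡[n+1]C[k+1] (c + h) i) ⟨
  a * (m * p) * ((c + h) C i + (c + h) C suc i)
    ≡⟨ distribute a m p ((c + h) C i) ((c + h) C suc i) ⟩
  a * (m * p) * ((c + h) C suc i) + m * (a * p * ((c + h) C i)) ∎
  where
  a = suc m ^ h
  p = m ^ i
  distribute : ∀ a m p x y → a * (m * p) * (x + y) ≡ a * (m * p) * y + m * (a * p * x)
  distribute = solve-∀
closedForm-oneFree m h c (suc d) zero    = sym (*-zeroʳ m)
closedForm-oneFree m h c (suc d) (suc i) = closedForm-oneFree m h c d i

closedForm-bothFree : ∀ m h c d i → closedForm m (suc h) c d i ≡ suc m * closedForm m h (suc c) d i
closedForm-bothFree m h c zero i rewrite +-suc c h =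
  reassociate (suc m) (suc m ^ h) (m ^ i) (suc (c + h) C i)
  where
  reassociate : ∀ n a p b → n * a * p * b ≡ n * (a * p * b)
  reassociate = solve-∀
closedForm-bothFree m h c (suc d) zero    = sym (*-zeroʳ (suc m))
closedForm-bothFree m h c (suc d) (suc i) = closedForm-bothFree m h c d i

bothFree leftOnly rightOnly oneFree agree disagree : ∀ {n} → Maybe (Fin n) → Maybe (Fin n) → ℕ
bothFree nothing nothing = 1
bothFree _       _       = 0
leftOnly (just _) nothing = 1
leftOnly _        _       = 0
rightOnly nothing (just _) = 1
rightOnly _       _        = 0
oneFree a b = leftOnly a b + rightOnly a b
agree (just u) (just v) = χ ⌊ u ≟F v ⌋
agree _        _        = 0
disagree (just u) (just v) = χ (not ⌊ u ≟F v ⌋)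
disagree _        _        = 0

coordinateFactor : ∀ m → Maybe (Fin (suc m)) → Maybe (Fin (suc m)) → ℕ → ℕ → ℕ
coordinateFactor m nothing  nothing   t f = suc m * (t + m * f)
coordinateFactor m nothing  (just _)  t f = t + m * f
coordinateFactor m (just _) nothing   t f = t + m * f
coordinateFactor m (just u) (just u′) t f = if ⌊ u ≟F u′ ⌋ then t else f

ΣFin²≡coordinateFactor : ∀ m (p q : Maybe (Fin (suc m))) (Z : Bool → ℕ) →
  ΣFin (suc m) (λ v → χ (precCoord p v) * ΣFin (suc m) (λ v′ → χ (precCoord q v′) * Z ⌊ v ≟F v′ ⌋))
    ≡ coordinateFactor m p q (Z true) (Z false)
ΣFin²≡coordinateFactor m nothing nothing Z = begin
  ΣFin (suc m) (λ v → 1 * ΣFin (suc m) (λ v′ → 1 * Z ⌊ v ≟F v′ ⌋))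
    ≡⟨ ΣFin-cong (suc m) inner ⟩
  ΣFin (suc m) (λ _ → Z true + m * Z false)
    ≡⟨ ΣFin-const (suc m) _ ⟩
  suc m * (Z true + m * Z false) ∎
  where
  inner : ∀ v → 1 * ΣFin (suc m) (λ v′ → 1 * Z ⌊ v ≟F v′ ⌋) ≡ Z true + m * Z false
  inner v = trans (*-identityˡ _) (trans (ΣFin-cong (suc m) (λ v′ → *-identityˡ _)) (ΣFin-split-≟ m v Z))
ΣFin²≡coordinateFactor m nothing (just u) Z = begin
  ΣFin (suc m) (λ v → 1 * ΣFin (suc m) (λ v′ → χ ⌊ u ≟F v′ ⌋ * Z ⌊ v ≟F v′ ⌋))
    ≡⟨ ΣFin-cong (suc m) inner ⟩
  ΣFin (suc m) (λ v → Z ⌊ u ≟F v ⌋)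
    ≡⟨ ΣFin-split-≟ m u Z ⟩
  Z true + m * Z false ∎
  where
  inner : ∀ v → 1 * ΣFin (suc m) (λ v′ → χ ⌊ u ≟F v′ ⌋ * Z ⌊ v ≟F v′ ⌋) ≡ Z ⌊ u ≟F v ⌋
  inner v = trans (*-identityˡ _) (trans (ΣFin-select (suc m) u _) (cong Z (⌊≟⌋-sym v u)))
ΣFin²≡coordinateFactor m (just u) nothing Z = begin
  ΣFin (suc m) (λ v → χ ⌊ u ≟F v ⌋ * ΣFin (suc m) (λ v′ → 1 * Z ⌊ v ≟F v′ ⌋))
    ≡⟨ ΣFin-select (suc m) u _ ⟩
  ΣFin (suc m) (λ v′ → 1 * Z ⌊ u ≟F v′ ⌋)
    ≡⟨ ΣFin-cong (suc m) (λ _ → *-identityˡ _) ⟩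
  ΣFin (suc m) (λ v′ → Z ⌊ u ≟F v′ ⌋)
    ≡⟨ ΣFin-split-≟ m u Z ⟩
  Z true + m * Z false ∎
ΣFin²≡coordinateFactor m (just u) (just u′) Z =
  trans (ΣFin-select (suc m) u _) (trans (ΣFin-select (suc m) u′ _) (byCases ⌊ u ≟F u′ ⌋))
  where
  byCases : ∀ b → Z b ≡ (if b then Z true else Z false)
  byCases true  = refl
  byCases false = refl

coordinateFactor-closedForm : ∀ m (p q : Maybe (Fin (suc m))) h c d i →
  coordinateFactor m p q (closedForm m h c d i) (closedForm m h c (suc d) i)
    ≡ closedForm m (bothFree p q + h) (oneFree p q + c) (disagree p q + d) i
coordinateFactor-closedForm m nothing nothing h c d i =
  trans (cong (suc m *_) (sym (closedForm-oneFree m h c d i))) (sym (closedForm-bothFree m h c d i))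
coordinateFactor-closedForm m nothing  (just _) h c d i = sym (closedForm-oneFree m h c d i)
coordinateFactor-closedForm m (just _) nothing  h c d i = sym (closedForm-oneFree m h c d i)
coordinateFactor-closedForm m (just u) (just u′) h c d i with ⌊ u ≟F u′ ⌋
... | true  = refl
... | false = refl

tally : ∀ {k n} → (Maybe (Fin n) → Maybe (Fin n) → ℕ) → SubWord k n → SubWord k n → ℕ
tally {k} κ x y = ΣFin k (λ j → κ (x j) (y j))

tally-∷ : ∀ {k n} κ (x y : SubWord (suc k) n) →
  tally κ x y ≡ κ (head x) (head y) + tally κ (tail x) (tail y)
tally-∷ {k} κ x y = ΣFin-suc k (λ j → κ (x j) (y j))

pairsAt≡closedForm : ∀ m k (x y : SubWord k (suc m)) i →
  pairsAt x y i ≡ closedForm m (tally bothFree x y) (tally oneFree x y) (tally disagree x y) i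
pairsAt≡closedForm m zero    x y zero    = refl
pairsAt≡closedForm m zero    x y (suc i) = sym (*-zeroʳ (1 * (m * m ^ i)))
pairsAt≡closedForm m (suc k) x y i
  rewrite tally-∷ bothFree x y | tally-∷ oneFree x y | tally-∷ disagree x y = begin
  pairsAt x y i
  
    ≡⟨ trans (pairsAt-∷ k (suc m) x y i)
             (ΣFin²≡coordinateFactor m (head x) (head y) (λ b → shift (χ (not b)) (pairsAt x′ y′) i)) ⟩
  coordinateFactor m (head x) (head y) (pairsAt x′ y′ i) (shift 1 (pairsAt x′ y′) i)
    ≡⟨ cong₂ (coordinateFactor m (head x) (head y)) (pairsAt≡closedForm m k x′ y′ i) (shifted i) ⟩
  coordinateFactor m (head x) (head y) (closedForm m h c d i) (closedForm m h c (suc d) i)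
    ≡⟨ coordinateFactor-closedForm m (head x) (head y) h c d i ⟩
  closedForm m (bothFree (head x) (head y) + h) (oneFree (head x) (head y) + c) (disagree (head x) (head y) + d) i ∎
  where
  x′ = tail x
  y′ = tail y
  h = tally bothFree x′ y′
  c = tally oneFree x′ y′
  d = tally disagree x′ y′
  shifted : ∀ i → shift 1 (pairsAt x′ y′) i ≡ closedForm m h c (suc d) i
  shifted zero    = refl
  shifted (suc i) = pairsAt≡closedForm m k x′ y′ i

-- Vandermonde's identity for the three convolutions in F

pascal : ∀ h l i → shift l (λ j → suc h C j) i ≡ shift l (λ j → h C j) i + shift (suc l) (λ j → h C j) i
pascal h zero    zero    = refl
pascal h zero    (suc i) = trans (sym (nCk+nC[k+1]≡[n+1]C[k+1] h i)) (+-comm (h C i) (h C suc i))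
pascal h (suc l) zero    = refl
pascal h (suc l) (suc i) = pascal h l i

pascal₂ : ∀ h l i → shift l (λ j → (2 + h) C j) i
  ≡ shift l (λ j → h C j) i + 2 * shift (1 + l) (λ j → h C j) i + shift (2 + l) (λ j → h C j) i
pascal₂ h l i = begin
  T (2 + h) l                                        ≡⟨ pascal (suc h) l i ⟩
  T (1 + h) l + T (1 + h) (1 + l)                    ≡⟨ cong₂ _+_ (pascal h l i) (pascal h (1 + l) i) ⟩
  T h l + T h (1 + l) + (T h (1 + l) + T h (2 + l))  ≡⟨ collect (T h l) (T h (1 + l)) (T h (2 + l)) ⟩
  T h l + 2 * T h (1 + l) + T h (2 + l)              ∎
  where
  T : ℕ → ℕ → ℕ
  T h l = shift l (λ j → h C j) i
  collect : ∀ a b c → a + b + (b + c) ≡ a + 2 * b + c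
  collect = solve-∀

binomialConvolution : ℕ → ℕ → ℕ → ℕ
binomialConvolution h c i = sumList (map (λ l → binomℤ h (+ i - + l) * (c C l)) (upTo (suc c)))

vandermonde : ∀ s → s ≤ 2 → ∀ h i → (2 * s + h) C i ≡ binomialConvolution h (2 * s) i
vandermonde s s≤2 h i = trans (expansion s s≤2) (cong sumList (map-cong shifted (upTo (suc (2 * s)))))
  where
  T : ℕ → ℕ
  T l = shift l (λ j → h C j) i

  shifted : ∀ l → T l * ((2 * s) C l) ≡ binomℤ h (+ i - + l) * ((2 * s) C l)
  shifted l = cong (_* ((2 * s) C l)) (sym (g[i-d]≡shift (binomℤ h) (λ _ → refl) l i))

  expansion : ∀ s → s ≤ 2 → (2 * s + h) C i ≡ sumList (map (λ l → T l * ((2 * s) C l)) (upTo (suc (2 * s))))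
  expansion 0 _ = sym (trans (+-identityʳ _) (*-identityʳ _))
  expansion 1 _ = trans (pascal₂ h 0 i) (coefficients₂ (T 0) (T 1) (T 2))
    where
    coefficients₂ : ∀ a b c → a + 2 * b + c ≡ a * 1 + (b * 2 + (c * 1 + 0))
    coefficients₂ = solve-∀
  expansion 2 _ = begin
    (4 + h) C i
      ≡⟨ pascal₂ (2 + h) 0 i ⟩
    U 0 + 2 * U 1 + U 2
      ≡⟨ cong₂ _+_ (cong₂ (λ a b → a + 2 * b) (pascal₂ h 0 i) (pascal₂ h 1 i)) (pascal₂ h 2 i) ⟩
    (T 0 + 2 * T 1 + T 2) + 2 * (T 1 + 2 * T 2 + T 3) + (T 2 + 2 * T 3 + T 4)
      ≡⟨ coefficients₄ (T 0) (T 1) (T 2) (T 3) (T 4) ⟩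
    T 0 * 1 + (T 1 * 4 + (T 2 * 6 + (T 3 * 4 + (T 4 * 1 + 0)))) ∎
    where
    U : ℕ → ℕ
    U l = shift l (λ j → (2 + h) C j) i
    coefficients₄ : ∀ a b c d e → a + 2 * b + c + 2 * (b + 2 * c + d) + (c + 2 * d + e)
                                  ≡ a * 1 + (b * 4 + (c * 6 + (d * 4 + (e * 1 + 0))))
    coefficients₄ = solve-∀
  expansion (suc (suc (suc _))) (s≤s (s≤s ()))

closedForm≡F : ∀ m h s → s ≤ 2 → ∀ i → closedForm m h (2 * s) 0 i ≡ F (suc m) s h (+ i)
closedForm≡F m h s s≤2 i = cong (suc m ^ h * m ^ i *_) (vandermonde s s≤2 h i)

closedForm≡F-shift : ∀ m h s → s ≤ 2 → ∀ d i → closedForm m h (2 * s) d i ≡ F (suc m) s h (+ i - + d)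
closedForm≡F-shift m h s s≤2 d i =
  trans (shift-cong (closedForm≡F m h s s≤2) d i) (sym (g[i-d]≡shift (F (suc m) s h) (λ _ → refl) d i))

weightedSum : (Fin 6 → ℕ) → (Fin 6 → ℕ) → ℕ
weightedSum c w = c 0F * w 0F + c 1F * w 1F + c 2F * w 2F + c 3F * w 3F + c 4F * w 4F + c 5F * w 5F

weightedSum-select : ∀ c r → weightedSum c (λ j → χ ⌊ r ≟F j ⌋) ≡ c r
weightedSum-select c r =
  trans (asΣFin (c 0F) (c 1F) (c 2F) (c 3F) (c 4F) (c 5F) _ _ _ _ _ _) (ΣFin-select 6 r c)
  where
  asΣFin : ∀ c₀ c₁ c₂ c₃ c₄ c₅ w₀ w₁ w₂ w₃ w₄ w₅ →
    c₀ * w₀ + c₁ * w₁ + c₂ * w₂ + c₃ * w₃ + c₄ * w₄ + c₅ * w₅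
      ≡ w₀ * c₀ + (w₁ * c₁ + (w₂ * c₂ + (w₃ * c₃ + (w₄ * c₄ + (w₅ * c₅ + 0)))))
  asΣFin = solve-∀

coefficients : ℕ → ℕ → ℕ → Fin 6 → ℕ
coefficients n k i 0F = F n 0 (k ∸ 2) (+ i)
coefficients n k i 1F = F n 0 (k ∸ 2) ((+ i) - (+ 1))
coefficients n k i 2F = F n 0 (k ∸ 2) ((+ i) - (+ 2))
coefficients n k i 3F = F n 1 (k ∸ 3) (+ i)
coefficients n k i 4F = F n 1 (k ∸ 3) ((+ i) - (+ 1))
coefficients n k i 5F = F n 2 (k ∸ 4) (+ i)

-- relationIndicators (sameEdge e f) (sameParts e f) (sharedVertices e f) (partsTouched e f) j unfolds to A'ⱼ e f.
relationIndicators : Bool → Bool → ℕ → ℕ → Fin 6 → ℕ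
relationIndicators same sameParts shared touched 0F = χ same
relationIndicators same sameParts shared touched 1F = χ (not same ∧ sameParts ∧ not ⌊ shared ℕ.≟ 0 ⌋)
relationIndicators same sameParts shared touched 2F = χ (sameParts ∧ not (not ⌊ shared ℕ.≟ 0 ⌋))
relationIndicators same sameParts shared touched 3F = χ (not ⌊ shared ℕ.≟ 0 ⌋ ∧ ⌊ touched ℕ.≟ 3 ⌋)
relationIndicators same sameParts shared touched 4F = χ (not (not ⌊ shared ℕ.≟ 0 ⌋) ∧ ⌊ touched ℕ.≟ 3 ⌋)
relationIndicators same sameParts shared touched 5F = χ (not (not ⌊ shared ℕ.≟ 0 ⌋) ∧ ⌊ touched ℕ.≟ 4 ⌋)

-- h, o, ag, ds, lo, ro count the bothFree, oneFree, agree, disagree, leftOnly and rightOnly coordinates;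
-- the two support equations leave six profiles, and in each of them exactly one indicator is 1.
edgePairFormula : ∀ m k i h o ag ds lo ro (same sameParts : Bool) (shared touched : ℕ) →
  ag + (ds + lo) ≡ 2 → ag + (ds + ro) ≡ 2 → o ≡ lo + ro → k ≡ touched + h →
  same ≡ (o + ds ≡ᵇ 0) → sameParts ≡ (o ≡ᵇ 0) → shared ≡ ag → touched ≡ o + (ag + ds) →
  closedForm m h o ds i ≡ weightedSum (coefficients (suc m) k i) (relationIndicators same sameParts shared touched)
edgePairFormula m k i h o 2 0 0 0 _ _ _ _ refl refl refl refl refl refl refl refl =
  trans (closedForm≡F m h 0 z≤n i) (sym (weightedSum-select (coefficients (suc m) k i) 0F))
edgePairFormula m k i h o 1 1 0 0 _ _ _ _ refl refl refl refl refl refl refl refl =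
  trans (closedForm≡F-shift m h 0 z≤n 1 i) (sym (weightedSum-select (coefficients (suc m) k i) 1F))
edgePairFormula m k i h o 0 2 0 0 _ _ _ _ refl refl refl refl refl refl refl refl =
  trans (closedForm≡F-shift m h 0 z≤n 2 i) (sym (weightedSum-select (coefficients (suc m) k i) 2F))
edgePairFormula m k i h o 1 0 1 1 _ _ _ _ refl refl refl refl refl refl refl refl =
  trans (closedForm≡F m h 1 (s≤s z≤n) i) (sym (weightedSum-select (coefficients (suc m) k i) 3F))
edgePairFormula m k i h o 0 1 1 1 _ _ _ _ refl refl refl refl refl refl refl refl =
  trans (closedForm≡F-shift m h 1 (s≤s z≤n) 1 i) (sym (weightedSum-select (coefficients (suc m) k i) 4F))
edgePairFormula m k i h o 0 0 2 2 _ _ _ _ refl refl refl refl refl refl refl refl =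
  trans (closedForm≡F m h 2 (s≤s (s≤s z≤n)) i) (sym (weightedSum-select (coefficients (suc m) k i) 5F))

module _ {n : ℕ} where

  inLeftSupport : (a b : Maybe (Fin n)) → χ (is-just a) ≡ agree a b + (disagree a b + leftOnly a b)
  inLeftSupport nothing  nothing  = refl
  inLeftSupport nothing  (just _) = refl
  inLeftSupport (just _) nothing  = refl
  inLeftSupport (just u) (just v) with ⌊ u ≟F v ⌋
  ... | true  = refl
  ... | false = refl

  inRightSupport : (a b : Maybe (Fin n)) → χ (is-just b) ≡ agree a b + (disagree a b + rightOnly a b)
  inRightSupport nothing  nothing  = refl
  inRightSupport nothing  (just _) = refl
  inRightSupport (just _) nothing  = refl
  inRightSupport (just u) (just v) with ⌊ u ≟F v ⌋
  ... | true  = refl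
  ... | false = refl

  inEitherSupport : (a b : Maybe (Fin n)) → χ (is-just a ∨ is-just b) ≡ oneFree a b + (agree a b + disagree a b)
  inEitherSupport nothing  nothing  = refl
  inEitherSupport nothing  (just _) = refl
  inEitherSupport (just _) nothing  = refl
  inEitherSupport (just u) (just v) with ⌊ u ≟F v ⌋
  ... | true  = refl
  ... | false = refl

  inEitherSupport+bothFree : (a b : Maybe (Fin n)) → χ (is-just a ∨ is-just b) + bothFree a b ≡ 1
  inEitherSupport+bothFree nothing  nothing  = refl
  inEitherSupport+bothFree nothing  (just _) = refl
  inEitherSupport+bothFree (just _) nothing  = refl
  inEitherSupport+bothFree (just _) (just _) = refl

  differentEntries : (a b : Maybe (Fin n)) → χ (not (eqMaybe a b)) ≡ oneFree a b + disagree a b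
  differentEntries nothing  nothing  = refl
  differentEntries nothing  (just _) = refl
  differentEntries (just _) nothing  = refl
  differentEntries (just u) (just v) with ⌊ u ≟F v ⌋
  ... | true  = refl
  ... | false = refl

  differentSupport : (a b : Maybe (Fin n)) → χ (not ⌊ is-just a Bool.≟ is-just b ⌋) ≡ oneFree a b
  differentSupport nothing  nothing  = refl
  differentSupport nothing  (just _) = refl
  differentSupport (just _) nothing  = refl
  differentSupport (just _) (just _) = refl

  sharedVertex : (a b : Maybe (Fin n)) → χ (is-just a ∧ eqMaybe a b) ≡ agree a b
  sharedVertex nothing  nothing  = refl
  sharedVertex nothing  (just _) = refl
  sharedVertex (just _) nothing  = refl
  sharedVertex (just _) (just _) = refl

allB≡count-not≡0 : ∀ k (p : Fin k → Bool) → allB k p ≡ (ΣFin k (λ j → χ (not (p j))) ≡ᵇ 0)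
allB≡count-not≡0 zero    p = refl
allB≡count-not≡0 (suc k) p rewrite ΣFin-suc k (λ j → χ (not (p j))) with p zero
... | true  = allB≡count-not≡0 k (p ∘ suc)
... | false = refl

tally-cong : ∀ {k n} {κ κ′ : Maybe (Fin n) → Maybe (Fin n) → ℕ} (x y : SubWord k n) →
  (∀ a b → κ a b ≡ κ′ a b) → tally κ x y ≡ tally κ′ x y
tally-cong {k} x y κ≗κ′ = ΣFin-cong k (λ j → κ≗κ′ (x j) (y j))

tally-+ : ∀ {k n} (κ κ′ : Maybe (Fin n) → Maybe (Fin n) → ℕ) (x y : SubWord k n) →
  tally (λ a b → κ a b + κ′ a b) x y ≡ tally κ x y + tally κ′ x y
tally-+ {k} κ κ′ x y = ΣFin-+ k (λ j → κ (x j) (y j)) (λ j → κ′ (x j) (y j))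

tally-+₃ : ∀ {k n} (κ₁ κ₂ κ₃ : Maybe (Fin n) → Maybe (Fin n) → ℕ) (x y : SubWord k n) →
  tally (λ a b → κ₁ a b + (κ₂ a b + κ₃ a b)) x y ≡ tally κ₁ x y + (tally κ₂ x y + tally κ₃ x y)
tally-+₃ κ₁ κ₂ κ₃ x y =
  trans (tally-+ κ₁ (λ a b → κ₂ a b + κ₃ a b) x y) (cong (_+_ (tally κ₁ x y)) (tally-+ κ₂ κ₃ x y))

module _ {k n : ℕ} (e f : Edge k n) where
  private
    x = proj₁ e
    y = proj₁ f

  suppSize-left : suppSize x ≡ tally agree x y + (tally disagree x y + tally leftOnly x y)
  suppSize-left = trans (tally-cong x y inLeftSupport) (tally-+₃ agree disagree leftOnly x y)

  suppSize-right : suppSize y ≡ tally agree x y + (tally disagree x y + tally rightOnly x y)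
  suppSize-right = trans (tally-cong x y inRightSupport) (tally-+₃ agree disagree rightOnly x y)

  tally-oneFree : tally oneFree x y ≡ tally leftOnly x y + tally rightOnly x y
  tally-oneFree = tally-+ leftOnly rightOnly x y

  partsTouched-tally : partsTouched e f ≡ tally oneFree x y + (tally agree x y + tally disagree x y)
  partsTouched-tally = trans (tally-cong x y inEitherSupport) (tally-+₃ oneFree agree disagree x y)

  k≡partsTouched+bothFree : k ≡ partsTouched e f + tally bothFree x y
  k≡partsTouched+bothFree = begin
    k
      ≡⟨ *-identityʳ k ⟨
    k * 1
      ≡⟨ ΣFin-const k 1 ⟨
    ΣFin k (λ _ → 1)
      ≡⟨ tally-cong x y inEitherSupport+bothFree ⟨
    tally (λ a b → χ (is-just a ∨ is-just b) + bothFree a b) x y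
      ≡⟨ tally-+ (λ a b → χ (is-just a ∨ is-just b)) bothFree x y ⟩
    partsTouched e f + tally bothFree x y ∎

  sameEdge-tally : sameEdge e f ≡ (tally oneFree x y + tally disagree x y ≡ᵇ 0)
  sameEdge-tally = trans (allB≡count-not≡0 k _)
    (cong (_≡ᵇ 0) (trans (tally-cong x y differentEntries) (tally-+ oneFree disagree x y)))

  sameParts-tally : sameParts e f ≡ (tally oneFree x y ≡ᵇ 0)
  sameParts-tally = trans (allB≡count-not≡0 k _) (cong (_≡ᵇ 0) (tally-cong x y differentSupport))

  sharedVertices-tally : sharedVertices e f ≡ tally agree x y
  sharedVertices-tally = tally-cong x y sharedVertex

proposition6p3 : (k n i : ℕ) → 3 ≤ k → 2 ≤ n → i ≤ k →
    (e f : Edge k n) →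
    WAWᵀ k n i e f ≡
    F n 0 (k ∸ 2) (+ i) * A'₀ e f
    + F n 0 (k ∸ 2) ((+ i) - (+ 1)) * A'₁ e f
    + F n 0 (k ∸ 2) ((+ i) - (+ 2)) * A'₂ e f
    + F n 1 (k ∸ 3) (+ i) * A'₃ e f
    + F n 1 (k ∸ 3) ((+ i) - (+ 1)) * A'₄ e f
    + F n 2 (k ∸ 4) (+ i) * A'₅ e f
proposition6p3 k zero    i _ () _ e f
proposition6p3 k (suc m) i _ _  _ e f =
  trans (pairsAt≡closedForm m k (proj₁ e) (proj₁ f) i)
        (edgePairFormula m k i _ _ _ _ _ _ _ _ _ _
          (trans (sym (suppSize-left e f)) (proj₂ e))
          (trans (sym (suppSize-right e f)) (proj₂ f))
          (tally-oneFree e f)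
          (k≡partsTouched+bothFree e f)
          (sameEdge-tally e f)
          (sameParts-tally e f)
          (sharedVertices-tally e f)
          (partsTouched-tally e f))
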